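{- Let $\Pi$ be a permutation of $\{1,\dots,n\}$, let $G=G[\Pi]$, and let $I$ be an independent set of $G$. Then there exists a parallel line representation of $G$ such that (1) the line segments corresponding to the vertices of $I$ are all vertical and pairwise distinct, and (2) the left-to-right order of the endpoints of the segments corresponding to vertices of $I$ is the same as the order of these vertices in $\Pi$ (i.e. the order by increasing $\Pi^{ -1}$).
   Context: For a permutation $\Pi$ of $\{1,\dots,n\}$, the graph $G[\Pi]$ has vertex set $\{1,\dots,n\}$ and $i,j$ adjacent iff $(i-j)(\Pi^{ -1}(i)-\Pi^{ -1}(j))<0$. A parallel line representation of a graph $G$ consists of two parallel horizontal lines in the Euclidean plane (a lower and an upper line) and, for each vertex $v$, a line segment joining a point of the lower line to a point of the upper line, such that two distinct vertices are adjacent iff their segments intersect. -}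

module Defs where

open import Data.Nat using (ℕ)
open import Data.Fin using (Fin; toℕ)
open import Data.Fin.Permutation using (Permutation′; _⟨$⟩ʳ_; _⟨$⟩ˡ_)
open import Data.Fin.Subset using (Subset; _∈_)
open import Data.Integer as ℤ using (ℤ; +_)
open import Data.Rational as ℚ using (ℚ; 0ℚ; 1ℚ)
open import Data.Product using (Σ; ∃; _×_; _,_; proj₁; proj₂)
open import Relation.Binary.PropositionalEquality using (_≡_)
open import Relation.Nullary using (¬_)
open import Function.Bundles using (_⇔_)

-- Vertices {1,…,n} are represented by Fin n (vertex k+1 ↔ element k; order preserved).
-- A permutation Π is an element of Permutation′ n; Π(i) = Π ⟨$⟩ʳ i and Π⁻¹(i) = Π ⟨$⟩ˡ i.

Π⁻¹ : {n : ℕ} → Permutation′ n → Fin n → Fin n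
Π⁻¹ Π i = Π ⟨$⟩ˡ i

Adj : {n : ℕ} → Permutation′ n → Fin n → Fin n → Set
Adj Π i j =
  ((+ toℕ i) ℤ.- (+ toℕ j)) ℤ.* ((+ toℕ (Π⁻¹ Π i)) ℤ.- (+ toℕ (Π⁻¹ Π j))) ℤ.< ℤ.0ℤ

IndependentSet : {n : ℕ} → Permutation′ n → Subset n → Set
IndependentSet Π I = ∀ i j → i ∈ I → j ∈ I → ¬ Adj Π i j

Point : Set
Point = ℚ × ℚ

Segment : Set
Segment = Point × Point

OnSegment : Point → Segment → Set
OnSegment (x , y) ((x₁ , y₁) , (x₂ , y₂)) =
  Σ ℚ λ t → (0ℚ ℚ.≤ t) × (t ℚ.≤ 1ℚ) ×
    (x ≡ x₁ ℚ.+ t ℚ.* (x₂ ℚ.- x₁)) × (y ≡ y₁ ℚ.+ t ℚ.* (y₂ ℚ.- y₁))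

Intersect : Segment → Segment → Set
Intersect s₁ s₂ = Σ Point λ p → OnSegment p s₁ × OnSegment p s₂

record ParallelLineRep {n : ℕ} (Π : Permutation′ n) : Set where
  field
    lowerY : ℚ
    upperY : ℚ
    lower<upper : lowerY ℚ.< upperY
    lowerX : Fin n → ℚ
    upperX : Fin n → ℚ

  segment : Fin n → Segment
  segment v = ((lowerX v , lowerY) , (upperX v , upperY))

  field
    adj⇔intersect : ∀ i j → ¬ (i ≡ j) → Adj Π i j ⇔ Intersect (segment i) (segment j)

open ParallelLineRep public

Vertical : {n : ℕ} {Π : Permutation′ n} → ParallelLineRep Π → Fin n → Set
Vertical R v = lowerX R v ≡ upperX R v

-- A permutation graph has the standard representation in which vertex v runs
-- from its value on the lower line to its position Π⁻¹(v) on the upper line: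
-- any lower coordinates increasing in v and upper coordinates increasing in
-- Π⁻¹(v) work, since two segments cross exactly when the two orders disagree.
-- An independent set I is a chain in both orders simultaneously, so the upper
-- coordinates can be chosen to take the value of the lower coordinate at every
-- vertex of I; then those segments are vertical and ordered as in Π.
module Submission where

open import Data.Empty using (⊥-elim)
open import Data.Fin as Fin using (Fin; toℕ; zero; suc)
open import Data.Fin.Permutation using (Permutation′; _⟨$⟩ʳ_; _⟨$⟩ˡ_; inverseˡ; inverseʳ)
open import Data.Fin.Properties using (toℕ-injective; toℕ<n)
open import Data.Fin.Subset using (Subset; _∈_)
open import Data.Fin.Subset.Properties using (_∈?_)
open import Data.Integer as ℤ using (ℤ; +_; -[1+_]; +[1+_]; _⊖_)
import Data.Integer.Properties as ℤ
open import Data.Nat using (ℕ; zero; suc; z≤n; s≤s)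
import Data.Nat.Coprimality as Coprime
open import Data.Product using (Σ; ∃-syntax; _×_; _,_; proj₁; proj₂)
open import Data.Rational as ℚ using (ℚ; 0ℚ; 1ℚ; mkℚ; 1/_)
import Data.Rational.Properties as ℚ
open import Data.Rational.Solver using (module +-*-Solver)
open import Data.Sum using (inj₁; inj₂)
open import Function using (_∘_)
open import Function.Bundles using (_⇔_; mk⇔)
open import Level using (0ℓ)
open import Relation.Binary.Definitions using (tri<; tri≈; tri>)
open import Relation.Binary.PropositionalEquality
open import Relation.Nullary using (¬_; yes; no)
open import Relation.Nullary.Decidable using (_×-dec_)
open import Relation.Unary using (Pred; Decidable)

open import Defs

segment₀₁ : ℚ → ℚ → Segment
segment₀₁ a b = ((a , 0ℚ) , (b , 1ℚ))

Intersect-sym : ∀ {s₁ s₂} → Intersect s₁ s₂ → Intersect s₂ s₁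
Intersect-sym (p , p∈s₁ , p∈s₂) = p , p∈s₂ , p∈s₁

module _ where
  open import Data.Rational using (_+_; _-_; _*_; _<_; _≤_; NonZero; Positive; NonNegative)
  open +-*-Solver

  p<q⇒0<q-p : ∀ {p q} → p < q → 0ℚ < q - p
  p<q⇒0<q-p {p} {q} p<q = subst (_< q - p) (ℚ.+-inverseʳ p) (ℚ.+-monoˡ-< (ℚ.- p) p<q)

  p≤q⇒0≤q-p : ∀ {p q} → p ≤ q → 0ℚ ≤ q - p
  p≤q⇒0≤q-p {p} {q} p≤q = subst (_≤ q - p) (ℚ.+-inverseʳ p) (ℚ.+-monoˡ-≤ (ℚ.- p) p≤q)

  convex-combination-pos : ∀ {x y t} → 0ℚ < x → 0ℚ < y → 0ℚ ≤ t → t ≤ 1ℚ →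
                           0ℚ < (1ℚ - t) * x + t * y
  convex-combination-pos {x} {y} {t} 0<x 0<y 0≤t t≤1 with ℚ.<-cmp 0ℚ t
  ... | tri> _ _ t<0 = ⊥-elim (ℚ.<-irrefl refl (ℚ.<-≤-trans t<0 0≤t))
  ... | tri≈ _ refl _ = subst (0ℚ <_) (sym (solve 2 (λ x y →
          (con 1ℚ :- con 0ℚ) :* x :+ con 0ℚ :* y := x) refl x y)) 0<x
  ... | tri< 0<t _ _ = subst (_< (1ℚ - t) * x + t * y) (ℚ.+-identityˡ 0ℚ)
          (ℚ.+-mono-≤-< 0≤[1-t]x 0<ty)
    where
    0≤[1-t]x : 0ℚ ≤ (1ℚ - t) * x
    0≤[1-t]x = subst (_≤ (1ℚ - t) * x) (ℚ.*-zeroʳ (1ℚ - t))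
      (ℚ.*-monoˡ-≤-nonNeg (1ℚ - t) {{ℚ.nonNegative (p≤q⇒0≤q-p t≤1)}} (ℚ.<⇒≤ 0<x))
    0<ty : 0ℚ < t * y
    0<ty = subst (_< t * y) (ℚ.*-zeroʳ t) (ℚ.*-monoʳ-<-pos t {{ℚ.positive 0<t}} 0<y)

  -- Both intersection points have the same height, hence the same parameter t,
  -- and at parameter t the horizontal gap is a convex combination of c - a and d - b.
  segments-disjoint : ∀ {a b c d} → a < c → b < d →
                      ¬ Intersect (segment₀₁ a b) (segment₀₁ c d)
  segments-disjoint {a} {b} {c} {d} a<c b<d
    ((x , y) , (t , 0≤t , t≤1 , x≡ , y≡) , (s , _ , _ , x≡′ , y≡′)) =
    ℚ.<-irrefl (sym gap≡0) (subst (0ℚ <_) (sym gap≡combination)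
      (convex-combination-pos (p<q⇒0<q-p a<c) (p<q⇒0<q-p b<d) 0≤t t≤1))
    where
    height : ∀ r → 0ℚ + r * (1ℚ - 0ℚ) ≡ r
    height = solve 1 (λ r → con 0ℚ :+ r :* (con 1ℚ :- con 0ℚ) := r) refl
    t≡s : t ≡ s
    t≡s = trans (sym (height t)) (trans (sym y≡) (trans y≡′ (height s)))
    gap≡0 : (c + t * (d - c)) - (a + t * (b - a)) ≡ 0ℚ
    gap≡0 = trans (cong (λ z → (c + t * (d - c)) - z) (trans (sym x≡) (trans x≡′
              (cong (λ r → c + r * (d - c)) (sym t≡s)))))
              (ℚ.+-inverseʳ (c + t * (d - c)))
    gap≡combination : (c + t * (d - c)) - (a + t * (b - a)) ≡ (1ℚ - t) * (c - a) + t * (d - b)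
    gap≡combination = solve 5 (λ a b c d t →
      (c :+ t :* (d :- c)) :- (a :+ t :* (b :- a)) := (con 1ℚ :- t) :* (c :- a) :+ t :* (d :- b))
      refl a b c d t

  -- The crossing happens at parameter t = (c - a) / ((c - a) + (b - d)).
  segments-cross : ∀ {a b c d} → a < c → d < b → Intersect (segment₀₁ a b) (segment₀₁ c d)
  segments-cross {a} {b} {c} {d} a<c d<b =
    (a + t * (b - a) , 0ℚ + t * (1ℚ - 0ℚ)) ,
    (t , 0≤t , t≤1 , refl , refl) , (t , 0≤t , t≤1 , x≡ , refl)
    where
    P = c - a
    S = P + (b - d)
    0<P : 0ℚ < P
    0<P = p<q⇒0<q-p a<c
    P<S : P < S
    P<S = subst (_< S) (ℚ.+-identityʳ P) (ℚ.+-monoʳ-< P (p<q⇒0<q-p d<b))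
    instance
      S-pos : Positive S
      S-pos = ℚ.positive (ℚ.<-trans 0<P P<S)
      S-nonZero : NonZero S
      S-nonZero = ℚ.pos⇒nonZero S
      1/S-nonNeg : NonNegative (1/ S)
      1/S-nonNeg = ℚ.pos⇒nonNeg (1/ S) {{ℚ.1/pos⇒pos S}}
    t : ℚ
    t = P * 1/ S
    0≤t : 0ℚ ≤ t
    0≤t = subst (_≤ t) (ℚ.*-zeroˡ (1/ S)) (ℚ.*-monoʳ-≤-nonNeg (1/ S) (ℚ.<⇒≤ 0<P))
    t≤1 : t ≤ 1ℚ
    t≤1 = subst (t ≤_) (ℚ.*-inverseʳ S) (ℚ.*-monoʳ-≤-nonNeg (1/ S) (ℚ.<⇒≤ P<S))
    tS≡P : t * S ≡ P
    tS≡P = trans (ℚ.*-assoc P (1/ S) S) (trans (cong (P *_) (ℚ.*-inverseˡ S)) (ℚ.*-identityʳ P))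
    x≡ : a + t * (b - a) ≡ c + t * (d - c)
    x≡ = begin
      a + t * (b - a)                     ≡⟨ solve 5 (λ a b c d t →
        a :+ t :* (b :- a) := (c :+ t :* (d :- c)) :+ (t :* ((c :- a) :+ (b :- d)) :- (c :- a)))
        refl a b c d t ⟩
      (c + t * (d - c)) + (t * S - P)     ≡⟨ cong (λ z → (c + t * (d - c)) + (z - P)) tS≡P ⟩
      (c + t * (d - c)) + (P - P)         ≡⟨ cong (λ z → (c + t * (d - c)) + z) (ℚ.+-inverseʳ P) ⟩
      (c + t * (d - c)) + 0ℚ              ≡⟨ ℚ.+-identityʳ _ ⟩
      c + t * (d - c)                     ∎
      where open ≡-Reasoning

open import Data.Nat using (_+_; _*_; _⊔_; _≤_; _<_)
open import Data.Nat.Properties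

fromℕ : ℕ → ℚ
fromℕ k = mkℚ (+ k) 0 (Coprime.sym (Coprime.1-coprimeTo k))

fromℕ-mono-< : ∀ {m n} → m < n → fromℕ m ℚ.< fromℕ n
fromℕ-mono-< {m} {n} m<n = ℚ.*<* (subst₂ ℤ._<_ (sym (ℤ.*-identityʳ (+ m)))
  (sym (ℤ.*-identityʳ (+ n))) (ℤ.+<+ m<n))

Δ : ℕ → ℕ → ℤ
Δ x y = + x ℤ.- + y

⊖-negative : ∀ {x y} → x < y → ∃[ k ] x ⊖ y ≡ -[1+ k ]
⊖-negative {zero} {suc k} _ = k , refl
⊖-negative {suc x} {suc y} (s≤s x<y) =
  let k , eq = ⊖-negative x<y in k , trans (ℤ.[1+m]⊖[1+n]≡m⊖n x y) eq

Δ-negative : ∀ {x y} → x < y → ∃[ k ] Δ x y ≡ -[1+ k ]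
Δ-negative {x} {y} x<y = let k , eq = ⊖-negative x<y in k , trans (ℤ.m-n≡m⊖n x y) eq

Δ-positive : ∀ {x y} → y < x → ∃[ k ] Δ x y ≡ +[1+ k ]
Δ-positive {x} {y} y<x =
  let k , eq = ⊖-negative y<x in k , trans (ℤ.m-n≡m⊖n x y) (trans (ℤ.⊖-swap x y) (cong ℤ.-_ eq))

Δ*Δ<0 : ∀ {x y z w} → x < y → w < z → Δ x y ℤ.* Δ z w ℤ.< ℤ.0ℤ
Δ*Δ<0 x<y w<z with Δ-negative x<y | Δ-positive w<z
... | _ , eq | _ , eq′ rewrite eq | eq′ = ℤ.-<+

Δ*Δ<0′ : ∀ {x y z w} → y < x → z < w → Δ x y ℤ.* Δ z w ℤ.< ℤ.0ℤ
Δ*Δ<0′ {x} {y} {z} {w} y<x z<w = subst (ℤ._< ℤ.0ℤ) (ℤ.*-comm (Δ z w) (Δ x y)) (Δ*Δ<0 z<w y<x)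

Δ*Δ≮0 : ∀ {x y z w} → x < y → z < w → ¬ (Δ x y ℤ.* Δ z w ℤ.< ℤ.0ℤ)
Δ*Δ≮0 x<y z<w with Δ-negative x<y | Δ-negative z<w
... | _ , eq | _ , eq′ rewrite eq | eq′ = λ { (ℤ.+<+ ()) }

Δ*Δ≮0′ : ∀ {x y z w} → y < x → w < z → ¬ (Δ x y ℤ.* Δ z w ℤ.< ℤ.0ℤ)
Δ*Δ≮0′ y<x w<z with Δ-positive y<x | Δ-positive w<z
... | _ , eq | _ , eq′ rewrite eq | eq′ = λ { (ℤ.+<+ ()) }

module _ {n : ℕ} (Π : Permutation′ n) where

  Π⁻¹-injective : ∀ {u v} → Π⁻¹ Π u ≡ Π⁻¹ Π v → u ≡ v
  Π⁻¹-injective {u} {v} eq = trans (sym (inverseʳ Π)) (trans (cong (Π ⟨$⟩ʳ_) eq) (inverseʳ Π))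

  parallelLineRep : (lower upper : Fin n → ℚ) →
                    (∀ {u v} → u Fin.< v → lower u ℚ.< lower v) →
                    (∀ {u v} → Π⁻¹ Π u Fin.< Π⁻¹ Π v → upper u ℚ.< upper v) →
                    ParallelLineRep Π
  parallelLineRep lower upper lower-mono upper-mono = record
    { lowerY = 0ℚ
    ; upperY = 1ℚ
    ; lower<upper = ℚ.*<* (ℤ.+<+ (s≤s z≤n))
    ; lowerX = lower
    ; upperX = upper
    ; adj⇔intersect = adj⇔cross
    }
    where
    seg : Fin n → Segment
    seg v = segment₀₁ (lower v) (upper v)
    adj⇔cross : ∀ i j → ¬ (i ≡ j) → Adj Π i j ⇔ Intersect (seg i) (seg j)
    adj⇔cross i j i≢j with <-cmp (toℕ i) (toℕ j) | <-cmp (toℕ (Π⁻¹ Π i)) (toℕ (Π⁻¹ Π j))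
    ... | tri≈ _ eq _ | _ = ⊥-elim (i≢j (toℕ-injective eq))
    ... | _ | tri≈ _ eq _ = ⊥-elim (i≢j (Π⁻¹-injective (toℕ-injective eq)))
    ... | tri< i<j _ _ | tri< πi<πj _ _ =
      mk⇔ (⊥-elim ∘ Δ*Δ≮0 i<j πi<πj) (⊥-elim ∘ segments-disjoint (lower-mono i<j) (upper-mono πi<πj))
    ... | tri< i<j _ _ | tri> _ _ πj<πi =
      mk⇔ (λ _ → segments-cross (lower-mono i<j) (upper-mono πj<πi)) (λ _ → Δ*Δ<0 i<j πj<πi)
    ... | tri> _ _ j<i | tri< πi<πj _ _ =
      mk⇔ (λ _ → Intersect-sym {seg j} {seg i} (segments-cross (lower-mono j<i) (upper-mono πi<πj)))
          (λ _ → Δ*Δ<0′ j<i πi<πj)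
    ... | tri> _ _ j<i | tri> _ _ πj<πi =
      mk⇔ (⊥-elim ∘ Δ*Δ≮0′ j<i πj<πi)
          (⊥-elim ∘ segments-disjoint (lower-mono j<i) (upper-mono πj<πi) ∘ Intersect-sym {seg i} {seg j})

maxOver : ∀ {n} {P : Pred (Fin n) 0ℓ} → Decidable P → (Fin n → ℕ) → ℕ
maxOver {zero} _ _ = 0
maxOver {suc n} P? w with P? zero
... | yes _ = w zero ⊔ maxOver (P? ∘ suc) (w ∘ suc)
... | no _ = maxOver (P? ∘ suc) (w ∘ suc)

≤-maxOver : ∀ {n} {P : Pred (Fin n) 0ℓ} (P? : Decidable P) (w : Fin n → ℕ) {u} →
            P u → w u ≤ maxOver P? w
≤-maxOver {suc n} P? w {u} Pu with P? zero | u
... | yes _ | zero = m≤m⊔n _ _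
... | yes _ | suc u′ = ≤-trans (≤-maxOver (P? ∘ suc) (w ∘ suc) Pu) (m≤n⊔m _ _)
... | no ¬P0 | zero = ⊥-elim (¬P0 Pu)
... | no _ | suc u′ = ≤-maxOver (P? ∘ suc) (w ∘ suc) Pu

maxOver-lub : ∀ {n} {P : Pred (Fin n) 0ℓ} (P? : Decidable P) (w : Fin n → ℕ) {m} →
              (∀ u → P u → w u ≤ m) → maxOver P? w ≤ m
maxOver-lub {zero} _ _ _ = z≤n
maxOver-lub {suc n} P? w bound with P? zero
... | yes P0 = ⊔-lub (bound zero P0) (maxOver-lub (P? ∘ suc) (w ∘ suc) (bound ∘ suc))
... | no _ = maxOver-lub (P? ∘ suc) (w ∘ suc) (bound ∘ suc)

-- The factor 1+n leaves room for the offset toℕ v + 1 added off T.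
module Interleave {n : ℕ} {T : Pred (Fin n) 0ℓ} (T? : Decidable T) (K : Fin n → ℕ)
  (K-mono : ∀ {u v} → u Fin.≤ v → K u ≤ K v)
  (K-strict : ∀ {u v} → T v → u Fin.< v → K u < K v) where

  interleave : Fin n → ℕ
  interleave v with T? v
  ... | yes _ = suc n * K v
  ... | no _ = suc n * K v + suc (toℕ v)

  interleave-≤ : ∀ u → interleave u ≤ suc n * K u + suc (toℕ u)
  interleave-≤ u with T? u
  ... | yes _ = m≤m+n _ _
  ... | no _ = ≤-refl

  interleave-on-T : ∀ {v} → T v → interleave v ≡ suc n * K v
  interleave-on-T {v} Tv with T? v
  ... | yes _ = refl
  ... | no ¬Tv = ⊥-elim (¬Tv Tv)

  interleave-strict : ∀ {u v} → u Fin.< v → interleave u < interleave v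
  interleave-strict {u} {v} u<v with T? v
  ... | yes Tv = begin-strict
    interleave u                    ≤⟨ interleave-≤ u ⟩
    suc n * K u + suc (toℕ u)       <⟨ +-monoʳ-< (suc n * K u) (s≤s (toℕ<n u)) ⟩
    suc n * K u + suc n             ≡⟨ +-comm (suc n * K u) (suc n) ⟩
    suc n + suc n * K u             ≡⟨ *-suc (suc n) (K u) ⟨
    suc n * suc (K u)               ≤⟨ *-monoʳ-≤ (suc n) (K-strict Tv u<v) ⟩
    suc n * K v                     ∎
    where open ≤-Reasoning
  ... | no _ = begin-strict
    interleave u                    ≤⟨ interleave-≤ u ⟩
    suc n * K u + suc (toℕ u)       <⟨ +-mono-≤-< (*-monoʳ-≤ (suc n) (K-mono (<⇒≤ u<v))) (s≤s u<v) ⟩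
    suc n * K v + suc (toℕ v)       ∎
    where open ≤-Reasoning

module Construction {n : ℕ} (Π : Permutation′ n) (I : Subset n) (indep : IndependentSet Π I) where

  π : Fin n → Fin n
  π r = Π ⟨$⟩ʳ r

  independent-mono : ∀ {r s} → π r ∈ I → π s ∈ I → r Fin.< s → π r Fin.< π s
  independent-mono {r} {s} πr∈I πs∈I r<s with <-cmp (toℕ (π r)) (toℕ (π s))
  ... | tri< πr<πs _ _ = πr<πs
  ... | tri≈ _ eq _ = ⊥-elim (<-irrefl (cong toℕ r≡s) r<s)
    where
    r≡s : r ≡ s
    r≡s = trans (sym (inverseˡ Π)) (trans (cong (Π ⟨$⟩ˡ_) (toℕ-injective eq)) (inverseˡ Π))
  ... | tri> _ _ πs<πr = ⊥-elim (indep (π r) (π s) πr∈I πs∈I (Δ*Δ<0′ πs<πr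
      (subst₂ (λ a b → toℕ a < toℕ b) (sym (inverseˡ Π)) (sym (inverseˡ Π)) r<s)))

  independent-mono-≤ : ∀ {r s} → π r ∈ I → π s ∈ I → r Fin.≤ s → π r Fin.≤ π s
  independent-mono-≤ πr∈I πs∈I r≤s with m≤n⇒m<n∨m≡n r≤s
  ... | inj₁ r<s = <⇒≤ (independent-mono πr∈I πs∈I r<s)
  ... | inj₂ r≡s = ≤-reflexive (cong (toℕ ∘ π) (toℕ-injective r≡s))

  placedUpTo? : (r : Fin n) → Decidable (λ s → π s ∈ I × s Fin.≤ r)
  placedUpTo? r s = (π s ∈? I) ×-dec (s Fin.≤? r)

  successorOfπ : Fin n → ℕ
  successorOfπ s = suc (toℕ (π s))

  key : Fin n → ℕ
  key r = maxOver (placedUpTo? r) successorOfπ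

  key-≥ : ∀ {r s} → π s ∈ I → s Fin.≤ r → suc (toℕ (π s)) ≤ key r
  key-≥ {r} πs∈I s≤r = ≤-maxOver (placedUpTo? r) successorOfπ (πs∈I , s≤r)

  key-≤ : ∀ {r m} → (∀ s → π s ∈ I → s Fin.≤ r → suc (toℕ (π s)) ≤ m) → key r ≤ m
  key-≤ {r} bound = maxOver-lub (placedUpTo? r) successorOfπ (λ s (πs∈I , s≤r) → bound s πs∈I s≤r)

  key-mono : ∀ {r r′} → r Fin.≤ r′ → key r ≤ key r′
  key-mono r≤r′ = key-≤ (λ s πs∈I s≤r → key-≥ πs∈I (≤-trans s≤r r≤r′))

  key-strict : ∀ {r s} → π s ∈ I → r Fin.< s → key r < key s
  key-strict πs∈I r<s = <-≤-trans
    (s≤s (key-≤ (λ s′ πs′∈I s′≤r → independent-mono πs′∈I πs∈I (≤-<-trans s′≤r r<s))))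
    (key-≥ πs∈I ≤-refl)

  key-at : ∀ {v} → v ∈ I → key (Π⁻¹ Π v) ≡ suc (toℕ v)
  key-at {v} v∈I = ≤-antisym
    (key-≤ (λ s πs∈I s≤r → s≤s (subst (λ u → toℕ (π s) ≤ toℕ u) (inverseʳ Π)
      (independent-mono-≤ πs∈I πr∈I s≤r))))
    (subst (λ u → suc (toℕ u) ≤ key (Π⁻¹ Π v)) (inverseʳ Π) (key-≥ πr∈I ≤-refl))
    where
    πr∈I : π (Π⁻¹ Π v) ∈ I
    πr∈I = subst (_∈ I) (sym (inverseʳ Π)) v∈I

  open Interleave (λ r → π r ∈? I) key key-mono key-strict

  lower : Fin n → ℚ
  lower v = fromℕ (suc n * suc (toℕ v))

  upper : Fin n → ℚ
  upper v = fromℕ (interleave (Π⁻¹ Π v))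

  lower-mono : ∀ {u v} → u Fin.< v → lower u ℚ.< lower v
  lower-mono u<v = fromℕ-mono-< (*-monoʳ-< (suc n) (s≤s u<v))

  upper-mono : ∀ {u v} → Π⁻¹ Π u Fin.< Π⁻¹ Π v → upper u ℚ.< upper v
  upper-mono πu<πv = fromℕ-mono-< (interleave-strict πu<πv)

  lower≡upper : ∀ {v} → v ∈ I → lower v ≡ upper v
  lower≡upper {v} v∈I = cong fromℕ (sym (trans
    (interleave-on-T (subst (_∈ I) (sym (inverseʳ Π)) v∈I))
    (cong (suc n *_) (key-at v∈I))))

lemma1 : (n : ℕ) (Π : Permutation′ n) (I : Subset n) → IndependentSet Π I →
    Σ (ParallelLineRep Π) λ R →
      ((∀ v → v ∈ I → Vertical R v) ×
       (∀ v w → v ∈ I → w ∈ I → ¬ (v ≡ w) → ¬ (segment R v ≡ segment R w))) ×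
      (∀ v w → v ∈ I → w ∈ I → Π⁻¹ Π v Fin.< Π⁻¹ Π w → lowerX R v ℚ.< lowerX R w)
lemma1 n Π I indep = R , ((vertical , distinct) , ordered)
  where
  open Construction Π I indep
  R : ParallelLineRep Π
  R = parallelLineRep Π lower upper lower-mono upper-mono

  vertical : ∀ v → v ∈ I → Vertical R v
  vertical v = lower≡upper

  distinct : ∀ v w → v ∈ I → w ∈ I → ¬ (v ≡ w) → ¬ (segment R v ≡ segment R w)
  distinct v w _ _ v≢w eq with <-cmp (toℕ v) (toℕ w)
  ... | tri< v<w _ _ = ℚ.<-irrefl (cong (proj₁ ∘ proj₁) eq) (lower-mono v<w)
  ... | tri≈ _ v≡w _ = v≢w (toℕ-injective v≡w)
  ... | tri> _ _ w<v = ℚ.<-irrefl (cong (proj₁ ∘ proj₁) (sym eq)) (lower-mono w<v)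

  ordered : ∀ v w → v ∈ I → w ∈ I → Π⁻¹ Π v Fin.< Π⁻¹ Π w → lowerX R v ℚ.< lowerX R w
  ordered v w v∈I w∈I πv<πw =
    subst₂ ℚ._<_ (sym (lower≡upper v∈I)) (sym (lower≡upper w∈I)) (upper-mono πv<πw)
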